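{- Let $(a_n)_{n\ge 0}$, $(b_n)_{n\ge 0}$ be sequences of complex numbers with $b_0=1$ and $a_n\ne 0$ for all $n\ge 0$. Let $\mathscr{A}$ be the infinite lower triangular matrix with entries $\mathscr{A}_{n,k}=a_nb_{n-k}a_k^{ -1}$ for $n\ge k\ge 0$ (and $0$ for $k>n$). Then for every integer $j$ (positive, zero or negative), the matrix power $\mathscr{A}^j$ belongs to $SDR_\infty$ (where $\mathscr{A}^0$ is the identity matrix).
   Context: All matrices are infinite lower triangular matrices $\mathscr{A}=(A_{n,k})_{n\ge k\ge 0}$ with complex entries; we set $A_{n,k}=0$ whenever $k>n$. For an integer $m\ge 3$, $\mathscr{A}$ is called an SDR-matrix of order $m$ (written $\mathscr{A}\in SDR_m$) if for all integers $n,k\ge 0$, all $2\le p\le m-1$ and all $0\le r\le p-1$, $$\prod_{i=0}^{r}A_{n+i,k+r-i}\prod_{i=0}^{p-r-1}A_{n+p-i,k+r+i+1}=\prod_{i=0}^{r}A_{n+p-i,k+p-r+i}\prod_{i=0}^{p-r-1}A_{n+i,k+p-r-i-1}.$$ $SDR_\infty$ denotes the set of matrices lying in $SDR_m$ for every $m\ge 3$. -}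

module Defs where

open import Level using (Level; _⊔_) renaming (suc to lsuc)
open import Data.Nat using (ℕ; zero; suc; _≤_; _<_; _≤?_; _≟_) renaming (_+_ to _+ℕ_; _∸_ to _∸ℕ_)
open import Data.Integer using (ℤ; +_; -[1+_])
open import Relation.Nullary using (¬_; yes; no)
open import Algebra.Bundles using (CommutativeRing)

record Field (c ℓ : Level) : Set (lsuc (c ⊔ ℓ)) where
  field
    commRing : CommutativeRing c ℓ
  open CommutativeRing commRing public
  field
    inv      : (x : Carrier) → ¬ (x ≈ 0#) → Carrier
    inverseʳ : (x : Carrier) (h : ¬ (x ≈ 0#)) → (x * inv x h) ≈ 1#
    1≉0      : ¬ (1# ≈ 0#)

module MatrixDefs {c ℓ : Level} (F : Field c ℓ) where
  open Field F

  -- infinite matrices, indexed (row, column)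
  Matrix : Set c
  Matrix = ℕ → ℕ → Carrier

  LowerTriangular : Matrix → Set ℓ
  LowerTriangular A = ∀ n k → n < k → A n k ≈ 0#

  -- Σ_{i=0}^{n} f i  and  Π_{i=0}^{n} f i  (inclusive upper bound)
  sumTo : ℕ → (ℕ → Carrier) → Carrier
  sumTo zero    f = f 0
  sumTo (suc n) f = sumTo n f + f (suc n)

  prodTo : ℕ → (ℕ → Carrier) → Carrier
  prodTo zero    f = f 0
  prodTo (suc n) f = prodTo n f * f (suc n)

  I : Matrix
  I n k with n ≟ k
  ... | yes _ = 1#
  ... | no  _ = 0#

  -- product of lower triangular matrices: (AB)_{n,k} = Σ_{i=0}^{n} A_{n,i} B_{i,k}
  -- (terms with i > n vanish since A is lower triangular)
  _·_ : Matrix → Matrix → Matrix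
  (A · B) n k = sumTo n (λ i → A n i * B i k)

  _^_ : Matrix → ℕ → Matrix
  A ^ zero  = I
  A ^ suc j = A · (A ^ j)

  _≋_ : Matrix → Matrix → Set ℓ
  A ≋ B = ∀ n k → A n k ≈ B n k

  IsInverse : Matrix → Matrix → Set ℓ
  IsInverse A B = LowerTriangular B × ((A · B) ≋ I) × ((B · A) ≋ I)
    where open import Data.Product using (_×_)

  zpow : Matrix → Matrix → ℤ → Matrix
  zpow A Ainv (+ j)      = A ^ j
  zpow A Ainv -[1+ j ]   = Ainv ^ suc j

  SDR : ℕ → Matrix → Set ℓ
  SDR m A = ∀ (n k p r : ℕ) → 2 ≤ p → p ≤ m ∸ℕ 1 → r ≤ p ∸ℕ 1 →
      (prodTo r (λ i → A (n +ℕ i) (k +ℕ r ∸ℕ i))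
        * prodTo (p ∸ℕ r ∸ℕ 1) (λ i → A (n +ℕ p ∸ℕ i) (k +ℕ r +ℕ i +ℕ 1)))
    ≈ (prodTo r (λ i → A (n +ℕ p ∸ℕ i) (k +ℕ p ∸ℕ r +ℕ i))
        * prodTo (p ∸ℕ r ∸ℕ 1) (λ i → A (n +ℕ i) (k +ℕ p ∸ℕ r ∸ℕ i ∸ℕ 1)))

  SDR∞ : Matrix → Set ℓ
  SDR∞ A = ∀ m → 3 ≤ m → SDR m A

  genMatrix : (a b : ℕ → Carrier) → (∀ n → ¬ (a n ≈ 0#)) → Matrix
  genMatrix a b ha n k with k ≤? n
  ... | yes _ = (a n * b (n ∸ℕ k)) * inv (a k) (ha k)
  ... | no  _ = 0#

-- Write D for the diagonal matrix diag(a_n).  Then A = D T D⁻¹ where T is the lower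
-- triangular Toeplitz matrix T_{n,k} = b_{n-k}.  Lower triangular Toeplitz matrices are
-- closed under products, and the inverse of a unitriangular one is again Toeplitz, so every
-- integer power of A is D T' D⁻¹ with T' lower triangular Toeplitz.  For any matrix the SDR
-- identities say that the product of two adjacent antidiagonal segments of lengths r+1 and
-- q+1 does not change when the two lengths are exchanged.  For D T' D⁻¹ such a product
-- splits into a product of a's over all rows involved, of a⁻¹'s over all columns involved,
-- and of two antidiagonal segments of T', which by Toeplitz shift invariance depend only on
-- their lengths; none of these factors sees the order of r and q.
module Submission where

open import Data.Empty using (⊥-elim)
open import Data.Integer using (ℤ; +_; -[1+_])
open import Data.Nat using (ℕ; zero; suc; z≤n; s≤s; s≤s⁻¹; _≤?_; _≟_)
  renaming (_+_ to _+ℕ_; _∸_ to _∸ℕ_; _≤_ to _≤ℕ_; _<_ to _<ℕ_)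
open import Data.Nat.Induction using (<-rec)
import Data.Nat.Properties as ℕₚ
open import Data.Nat.Tactic.RingSolver using (solve-∀)
open import Data.Product using (Σ-syntax; _×_; _,_; proj₁; proj₂)
open import Level using (Level; _⊔_)
open import Relation.Binary.Bundles using (Setoid)
import Relation.Binary.PropositionalEquality as ≡
import Relation.Binary.Reasoning.Setoid as SetoidReasoning
open import Relation.Nullary using (¬_; yes; no)
open import Defs

module Index where
  open import Data.Nat using (_+_; _∸_; _≤_)
  open import Data.Nat.Properties
  open ≡ using (_≡_; cong)
  open ≡.≡-Reasoning

  private
    k+[1+r+q]≡k+1+q+r : ∀ k r q → k + suc (r + q) ≡ k + suc q + r
    k+[1+r+q]≡k+1+q+r = solve-∀

    n+[1+r+q]≡1+r+n+q : ∀ n r q → n + suc (r + q) ≡ suc r + n + q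
    n+[1+r+q]≡1+r+n+q = solve-∀

  k+[1+r+q]∸r≡k+1+q : ∀ k r q → k + suc (r + q) ∸ r ≡ k + suc q
  k+[1+r+q]∸r≡k+1+q k r q = begin
    k + suc (r + q) ∸ r  ≡⟨ cong (_∸ r) (k+[1+r+q]≡k+1+q+r k r q) ⟩
    k + suc q + r ∸ r    ≡⟨ m+n∸n≡m (k + suc q) r ⟩
    k + suc q            ∎

  [1+r+q]∸r∸1≡q : ∀ r q → suc (r + q) ∸ r ∸ 1 ≡ q
  [1+r+q]∸r∸1≡q r q = cong (_∸ 1) (k+[1+r+q]∸r≡k+1+q 0 r q)

  n+[1+r+q]∸[q∸i]≡1+r+n+i : ∀ n r {q i} → i ≤ q → n + suc (r + q) ∸ (q ∸ i) ≡ suc r + n + i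
  n+[1+r+q]∸[q∸i]≡1+r+n+i n r {q} {i} i≤q = begin
    n + suc (r + q) ∸ (q ∸ i)    ≡⟨ cong (_∸ (q ∸ i)) (n+[1+r+q]≡1+r+n+q n r q) ⟩
    suc r + n + q ∸ (q ∸ i)      ≡⟨ +-∸-assoc (suc r + n) (m∸n≤m q i) ⟩
    suc r + n + (q ∸ (q ∸ i))    ≡⟨ cong (_+_ (suc r + n)) (m∸[m∸n]≡n i≤q) ⟩
    suc r + n + i                ∎

  n+[1+r+q]∸[r∸i]≡1+q+n+i : ∀ n {r} q {i} → i ≤ r → n + suc (r + q) ∸ (r ∸ i) ≡ suc q + n + i
  n+[1+r+q]∸[r∸i]≡1+q+n+i n {r} q {i} i≤r = begin
    n + suc (r + q) ∸ (r ∸ i)  ≡⟨ cong (λ x → n + suc x ∸ (r ∸ i)) (+-comm r q) ⟩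
    n + suc (q + r) ∸ (r ∸ i)  ≡⟨ n+[1+r+q]∸[q∸i]≡1+r+n+i n q i≤r ⟩
    suc q + n + i              ∎

  k+r+x+1≡1+r+k+x : ∀ k r x → k + r + x + 1 ≡ suc r + k + x
  k+r+x+1≡1+r+k+x = solve-∀

  k+[1+r+q]∸r+x≡1+q+k+x : ∀ k r q x → k + suc (r + q) ∸ r + x ≡ suc q + k + x
  k+[1+r+q]∸r+x≡1+q+k+x k r q x = begin
    k + suc (r + q) ∸ r + x  ≡⟨ cong (_+ x) (k+[1+r+q]∸r≡k+1+q k r q) ⟩
    k + suc q + x            ≡⟨ cong (_+ x) (+-comm k (suc q)) ⟩
    suc q + k + x            ∎

  k+[1+r+q]∸r∸i∸1≡k+[q∸i] : ∀ k r {q i} → i ≤ q → k + suc (r + q) ∸ r ∸ i ∸ 1 ≡ k + (q ∸ i)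
  k+[1+r+q]∸r∸i∸1≡k+[q∸i] k r {q} {i} i≤q = begin
    k + suc (r + q) ∸ r ∸ i ∸ 1  ≡⟨ cong (λ x → x ∸ i ∸ 1) (k+[1+r+q]∸r≡k+1+q k r q) ⟩
    k + suc q ∸ i ∸ 1            ≡⟨ cong (λ x → x ∸ i ∸ 1) (+-suc k q) ⟩
    suc (k + q) ∸ i ∸ 1          ≡⟨ ∸-+-assoc (suc (k + q)) i 1 ⟩
    suc (k + q) ∸ (i + 1)        ≡⟨ cong (suc (k + q) ∸_) (+-comm i 1) ⟩
    k + q ∸ i                    ≡⟨ +-∸-assoc k i≤q ⟩
    k + (q ∸ i)                  ∎

  1+r+n+i≡n+[1+r+i] : ∀ r n i → suc r + n + i ≡ n + suc (r + i)
  1+r+n+i≡n+[1+r+i] = solve-∀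

open Index

module Matrices {c ℓ : Level} (F : Field c ℓ) where
  open Field F
  open MatrixDefs F
  open import Algebra.Properties.CommutativeSemigroup *-commutativeSemigroup using (interchange)
  open import Algebra.Properties.AbelianGroup +-abelianGroup using (∙-cancelˡ)
  open import Algebra.Solver.Ring.NaturalCoefficients.Default commutativeSemiring
    using (solve; _:*_; _:=_)
  module ≈-Reasoning = SetoidReasoning setoid

  sumTo-cong : ∀ n {f g : ℕ → Carrier} → (∀ i → i ≤ℕ n → f i ≈ g i) → sumTo n f ≈ sumTo n g
  sumTo-cong zero    f≈g = f≈g 0 z≤n
  sumTo-cong (suc n) f≈g = +-cong (sumTo-cong n (λ i i≤n → f≈g i (ℕₚ.m≤n⇒m≤1+n i≤n))) (f≈g (suc n) ℕₚ.≤-refl)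

  sumTo-zero : ∀ n {f : ℕ → Carrier} → (∀ i → i ≤ℕ n → f i ≈ 0#) → sumTo n f ≈ 0#
  sumTo-zero zero    f≈0 = f≈0 0 z≤n
  sumTo-zero (suc n) f≈0 =
    trans (+-cong (sumTo-zero n (λ i i≤n → f≈0 i (ℕₚ.m≤n⇒m≤1+n i≤n))) (f≈0 (suc n) ℕₚ.≤-refl)) (+-identityʳ 0#)

  sumTo-suc : ∀ n (f : ℕ → Carrier) → sumTo (suc n) f ≈ f 0 + sumTo n (λ i → f (suc i))
  sumTo-suc zero    f = refl
  sumTo-suc (suc n) f = trans (+-congʳ (sumTo-suc n f)) (+-assoc _ _ _)

  sumTo-factor : ∀ n x y (f : ℕ → Carrier) → sumTo n (λ i → (x * f i) * y) ≈ (x * sumTo n f) * y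
  sumTo-factor zero    x y f = refl
  sumTo-factor (suc n) x y f = trans (+-congʳ (sumTo-factor n x y f))
    (sym (trans (*-congʳ (distribˡ x (sumTo n f) (f (suc n)))) (distribʳ y _ _)))

  prodTo-cong : ∀ n {f g : ℕ → Carrier} → (∀ i → i ≤ℕ n → f i ≈ g i) → prodTo n f ≈ prodTo n g
  prodTo-cong zero    f≈g = f≈g 0 z≤n
  prodTo-cong (suc n) f≈g = *-cong (prodTo-cong n (λ i i≤n → f≈g i (ℕₚ.m≤n⇒m≤1+n i≤n))) (f≈g (suc n) ℕₚ.≤-refl)

  prodTo-* : ∀ n (f g : ℕ → Carrier) → prodTo n (λ i → f i * g i) ≈ prodTo n f * prodTo n g
  prodTo-* zero    f g = refl
  prodTo-* (suc n) f g = trans (*-congʳ (prodTo-* n f g)) (interchange _ _ _ _)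

  prodTo-suc : ∀ n (f : ℕ → Carrier) → prodTo (suc n) f ≈ f 0 * prodTo n (λ i → f (suc i))
  prodTo-suc zero    f = refl
  prodTo-suc (suc n) f = trans (*-congʳ (prodTo-suc n f)) (*-assoc _ _ _)

  prodTo-reverse : ∀ n (f : ℕ → Carrier) → prodTo n (λ i → f (n ∸ℕ i)) ≈ prodTo n f
  prodTo-reverse zero    f = refl
  prodTo-reverse (suc n) f = begin
    prodTo n (λ i → f (suc n ∸ℕ i)) * f (n ∸ℕ n)
      ≈⟨ *-cong (prodTo-cong n (λ i i≤n → reflexive (≡.cong f (ℕₚ.+-∸-assoc 1 i≤n))))
                (reflexive (≡.cong f (ℕₚ.n∸n≡0 n))) ⟩
    prodTo n (λ i → f (suc (n ∸ℕ i))) * f 0   ≈⟨ *-congʳ (prodTo-reverse n (λ i → f (suc i))) ⟩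
    prodTo n (λ i → f (suc i)) * f 0          ≈⟨ *-comm _ _ ⟩
    f 0 * prodTo n (λ i → f (suc i))          ≈⟨ prodTo-suc n f ⟨
    prodTo (suc n) f                          ∎
    where open ≈-Reasoning

  prodTo-reverse-cong : ∀ n {f g : ℕ → Carrier} → (∀ i → i ≤ℕ n → f (n ∸ℕ i) ≈ g i) →
    prodTo n f ≈ prodTo n g
  prodTo-reverse-cong n f≈g = trans (sym (prodTo-reverse n _)) (prodTo-cong n f≈g)

  prodTo-append : ∀ r q (f : ℕ → Carrier) →
    prodTo r f * prodTo q (λ i → f (suc (r +ℕ i))) ≈ prodTo (suc (r +ℕ q)) f
  prodTo-append r zero    f rewrite ℕₚ.+-identityʳ r = refl
  prodTo-append r (suc q) f rewrite ℕₚ.+-suc r q =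
    trans (sym (*-assoc _ _ _)) (*-congʳ (prodTo-append r q f))

  ≋-setoid : Setoid c ℓ
  ≋-setoid = record
    { Carrier       = Matrix
    ; _≈_           = _≋_
    ; isEquivalence = record
      { refl  = λ _ _ → refl
      ; sym   = λ A≋B n k → sym (A≋B n k)
      ; trans = λ A≋B B≋C n k → trans (A≋B n k) (B≋C n k)
      }
    }

  module ≋ = Setoid ≋-setoid
  module ≋-Reasoning = SetoidReasoning ≋-setoid

  ·-cong : ∀ {A A′ B B′} → A ≋ A′ → B ≋ B′ → (A · B) ≋ (A′ · B′)
  ·-cong A≋A′ B≋B′ n k = sumTo-cong n (λ i _ → *-cong (A≋A′ n i) (B≋B′ i k))

  ^-cong : ∀ {A B} → A ≋ B → ∀ j → (A ^ j) ≋ (B ^ j)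
  ^-cong A≋B zero    = ≋.refl
  ^-cong A≋B (suc j) = ·-cong A≋B (^-cong A≋B j)

  I-diagonal : ∀ (x y : ℕ → Carrier) → (∀ n → x n * y n ≈ 1#) → ∀ n k → (x n * I n k) * y k ≈ I n k
  I-diagonal x y xy≈1 n k with n ≟ k
  ... | yes ≡.refl = trans (*-congʳ (*-identityʳ (x n))) (xy≈1 n)
  ... | no  _      = trans (*-congʳ (zeroʳ (x n))) (zeroˡ (y k))

  I-lowerTriangular : LowerTriangular I
  I-lowerTriangular n k n<k with n ≟ k
  ... | yes ≡.refl = ⊥-elim (ℕₚ.<-irrefl ≡.refl n<k)
  ... | no  _      = refl

  ·-lowerTriangular : ∀ {A B} → LowerTriangular B → LowerTriangular (A · B)
  ·-lowerTriangular {A} {B} B-low n k n<k =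
    sumTo-zero n (λ i i≤n → trans (*-congˡ (B-low i k (ℕₚ.≤-<-trans i≤n n<k))) (zeroʳ (A n i)))

  ^-lowerTriangular : ∀ {A} → LowerTriangular A → ∀ j → LowerTriangular (A ^ j)
  ^-lowerTriangular A-low zero    = I-lowerTriangular
  ^-lowerTriangular A-low (suc j) = ·-lowerTriangular (^-lowerTriangular A-low j)

  shift : Matrix → Matrix
  shift A n k = A (suc n) (suc k)

  Toeplitz : Matrix → Set ℓ
  Toeplitz A = shift A ≋ A

  Toeplitz-+ : ∀ {A} → Toeplitz A → ∀ s n k → A (s +ℕ n) (s +ℕ k) ≈ A n k
  Toeplitz-+ A-toe zero    n k = refl
  Toeplitz-+ A-toe (suc s) n k = trans (A-toe (s +ℕ n) (s +ℕ k)) (Toeplitz-+ A-toe s n k)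

  I-Toeplitz : Toeplitz I
  I-Toeplitz n k with n ≟ k | suc n ≟ suc k
  ... | yes _  | yes _   = refl
  ... | no  _  | no  _   = refl
  ... | yes n≡k | no sn≢sk = ⊥-elim (sn≢sk (≡.cong suc n≡k))
  ... | no n≢k | yes sn≡sk = ⊥-elim (n≢k (ℕₚ.suc-injective sn≡sk))

  ·-shift : ∀ {A B} → Toeplitz A → LowerTriangular B → ∀ n k → (A · B) (suc n) (suc k) ≈ (A · shift B) n k
  ·-shift {A} {B} A-toe B-low n k = begin
    (A · B) (suc n) (suc k)
      ≈⟨ sumTo-suc n (λ i → A (suc n) i * B i (suc k)) ⟩
    A (suc n) 0 * B 0 (suc k) + sumTo n (λ i → A (suc n) (suc i) * B (suc i) (suc k))
      ≈⟨ +-cong (trans (*-congˡ (B-low 0 (suc k) (s≤s z≤n))) (zeroʳ _))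
                (sumTo-cong n (λ i _ → *-congʳ (A-toe n i))) ⟩
    0# + (A · shift B) n k
      ≈⟨ +-identityˡ _ ⟩
    (A · shift B) n k ∎
    where open ≈-Reasoning

  ·-Toeplitz : ∀ {A B} → Toeplitz A → Toeplitz B → LowerTriangular B → Toeplitz (A · B)
  ·-Toeplitz {A} A-toe B-toe B-low n k = trans (·-shift A-toe B-low n k) (·-cong (≋.refl {A}) B-toe n k)

  ^-Toeplitz : ∀ {A} → Toeplitz A → LowerTriangular A → ∀ j → Toeplitz (A ^ j)
  ^-Toeplitz A-toe A-low zero    = I-Toeplitz
  ^-Toeplitz A-toe A-low (suc j) =
    ·-Toeplitz A-toe (^-Toeplitz A-toe A-low j) (^-lowerTriangular A-low j)

  -- Row n of A · X is determined by the rows of X up to n, and involves row n only through A n n.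
  ·-cancelˡ : ∀ {A X Y} → (∀ n → A n n ≈ 1#) → (A · X) ≋ (A · Y) → X ≋ Y
  ·-cancelˡ {A} {X} {Y} A-unit AX≋AY = <-rec (λ n → ∀ k → X n k ≈ Y n k) row
    where
    unit : ∀ Z n k → Z n k ≈ A n n * Z n k
    unit Z n k = trans (sym (*-identityˡ _)) (*-congʳ (sym (A-unit n)))

    row : ∀ n → (∀ {i} → i <ℕ n → ∀ k → X i k ≈ Y i k) → ∀ k → X n k ≈ Y n k
    row zero    _    k = trans (unit X 0 k) (trans (AX≋AY 0 k) (sym (unit Y 0 k)))
    row (suc n) rows k = trans (unit X (suc n) k) (trans last (sym (unit Y (suc n) k)))
      where
      earlier : sumTo n (λ i → A (suc n) i * X i k) ≈ sumTo n (λ i → A (suc n) i * Y i k)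
      earlier = sumTo-cong n (λ i i≤n → *-congˡ (rows (s≤s i≤n) k))

      last : A (suc n) (suc n) * X (suc n) k ≈ A (suc n) (suc n) * Y (suc n) k
      last = ∙-cancelˡ _ _ _ (trans (AX≋AY (suc n) k) (+-congʳ (sym earlier)))

  lowerToeplitz : (ℕ → Carrier) → Matrix
  lowerToeplitz b n k with k ≤? n
  ... | yes _ = b (n ∸ℕ k)
  ... | no  _ = 0#

  lowerToeplitz-lowerTriangular : ∀ b → LowerTriangular (lowerToeplitz b)
  lowerToeplitz-lowerTriangular b n k n<k with k ≤? n
  ... | yes k≤n = ⊥-elim (ℕₚ.<⇒≱ n<k k≤n)
  ... | no  _   = refl

  lowerToeplitz-Toeplitz : ∀ b → Toeplitz (lowerToeplitz b)
  lowerToeplitz-Toeplitz b n k with k ≤? n | suc k ≤? suc n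
  ... | yes _   | yes _     = refl
  ... | no  _   | no  _     = refl
  ... | yes k≤n | no sk≰sn  = ⊥-elim (sk≰sn (s≤s k≤n))
  ... | no k≰n  | yes sk≤sn = ⊥-elim (k≰n (s≤s⁻¹ sk≤sn))

  lowerToeplitz-diagonal : ∀ b n → lowerToeplitz b n n ≈ b 0
  lowerToeplitz-diagonal b n with n ≤? n
  ... | yes _   = reflexive (≡.cong b (ℕₚ.n∸n≡0 n))
  ... | no  n≰n = ⊥-elim (n≰n ℕₚ.≤-refl)

  antidiagonal : Matrix → ℕ → ℕ → ℕ → Carrier
  antidiagonal M n k r = prodTo r (λ i → M (n +ℕ i) (k +ℕ (r ∸ℕ i)))

  antidiagonal-cong : ∀ {M M′} → M ≋ M′ → ∀ n k r → antidiagonal M n k r ≈ antidiagonal M′ n k r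
  antidiagonal-cong M≋M′ n k r = prodTo-cong r (λ i _ → M≋M′ _ _)

  antidiagonal-Toeplitz : ∀ {T} → Toeplitz T → ∀ s n k r →
    antidiagonal T (s +ℕ n) (s +ℕ k) r ≈ antidiagonal T n k r
  antidiagonal-Toeplitz {T} T-toe s n k r = prodTo-cong r (λ i _ →
    trans (reflexive (≡.cong₂ T (ℕₚ.+-assoc s n i) (ℕₚ.+-assoc s k (r ∸ℕ i))))
          (Toeplitz-+ T-toe s (n +ℕ i) (k +ℕ (r ∸ℕ i))))

  AntidiagonalExchange : Matrix → Set ℓ
  AntidiagonalExchange M = ∀ n k r q →
    antidiagonal M n k r * antidiagonal M (suc r +ℕ n) (suc r +ℕ k) q
      ≈ antidiagonal M (suc q +ℕ n) (suc q +ℕ k) r * antidiagonal M n k q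

  AntidiagonalExchange-resp : ∀ {M M′} → M ≋ M′ → AntidiagonalExchange M → AntidiagonalExchange M′
  AntidiagonalExchange-resp {M} {M′} M≋M′ exchange n k r q =
    trans (*-cong (sym (cong n k r)) (sym (cong (suc r +ℕ n) (suc r +ℕ k) q)))
      (trans (exchange n k r q) (*-cong (cong (suc q +ℕ n) (suc q +ℕ k) r) (cong n k q)))
    where
    cong : ∀ n k r → antidiagonal M n k r ≈ antidiagonal M′ n k r
    cong = antidiagonal-cong M≋M′

  -- With p = 1 + r + q, the four products of the SDR condition are, after reversing the
  -- second and third, the antidiagonal segments of the exchange.
  antidiagonalExchange⇒SDR∞ : ∀ {M} → AntidiagonalExchange M → SDR∞ M
  antidiagonalExchange⇒SDR∞ {M} exchange _ _ n k (suc p) r (s≤s _) _ r≤p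
    with p ∸ℕ r | ℕₚ.m+[n∸m]≡n r≤p
  ... | q | ≡.refl rewrite [1+r+q]∸r∸1≡q r q =
    trans (*-cong first second) (trans (exchange n k r q) (sym (*-cong third fourth)))
    where
    first : prodTo r (λ i → M (n +ℕ i) (k +ℕ r ∸ℕ i)) ≈ antidiagonal M n k r
    first = prodTo-cong r (λ i i≤r → reflexive (≡.cong (M (n +ℕ i)) (ℕₚ.+-∸-assoc k i≤r)))

    second : prodTo q (λ i → M (n +ℕ suc (r +ℕ q) ∸ℕ i) (k +ℕ r +ℕ i +ℕ 1))
           ≈ antidiagonal M (suc r +ℕ n) (suc r +ℕ k) q
    second = prodTo-reverse-cong q (λ i i≤q → reflexive
      (≡.cong₂ M (n+[1+r+q]∸[q∸i]≡1+r+n+i n r i≤q) (k+r+x+1≡1+r+k+x k r (q ∸ℕ i))))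

    third : prodTo r (λ i → M (n +ℕ suc (r +ℕ q) ∸ℕ i) (k +ℕ suc (r +ℕ q) ∸ℕ r +ℕ i))
          ≈ antidiagonal M (suc q +ℕ n) (suc q +ℕ k) r
    third = prodTo-reverse-cong r (λ i i≤r → reflexive
      (≡.cong₂ M (n+[1+r+q]∸[r∸i]≡1+q+n+i n q i≤r) (k+[1+r+q]∸r+x≡1+q+k+x k r q (r ∸ℕ i))))

    fourth : prodTo q (λ i → M (n +ℕ i) (k +ℕ suc (r +ℕ q) ∸ℕ r ∸ℕ i ∸ℕ 1)) ≈ antidiagonal M n k q
    fourth = prodTo-cong q (λ i i≤q → reflexive (≡.cong (M (n +ℕ i)) (k+[1+r+q]∸r∸i∸1≡k+[q∸i] k r i≤q)))

  segment : (ℕ → Carrier) → ℕ → ℕ → Carrier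
  segment f n r = prodTo r (λ i → f (n +ℕ i))

  segment-append : ∀ f n r q → segment f n r * segment f (suc r +ℕ n) q ≈ segment f n (suc (r +ℕ q))
  segment-append f n r q = trans
    (*-congˡ (prodTo-cong q (λ i _ → reflexive (≡.cong f (1+r+n+i≡n+[1+r+i] r n i)))))
    (prodTo-append r q (λ i → f (n +ℕ i)))

  cancel-sandwich : ∀ {x x′ y y′} → x * x′ ≈ 1# → y * y′ ≈ 1# → ∀ m → (x * ((x′ * m) * y)) * y′ ≈ m
  cancel-sandwich {x} {x′} {y} {y′} xx′≈1 yy′≈1 m = begin
    (x * ((x′ * m) * y)) * y′  ≈⟨ regroup x x′ m y y′ ⟩
    ((x * x′) * m) * (y * y′)  ≈⟨ *-cong (*-congʳ xx′≈1) yy′≈1 ⟩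
    (1# * m) * 1#              ≈⟨ *-identityʳ _ ⟩
    1# * m                     ≈⟨ *-identityˡ m ⟩
    m                          ∎
    where
    open ≈-Reasoning
    regroup : ∀ x x′ m y y′ → (x * ((x′ * m) * y)) * y′ ≈ ((x * x′) * m) * (y * y′)
    regroup = solve 5 (λ x x′ m y y′ → (x :* ((x′ :* m) :* y)) :* y′ := ((x :* x′) :* m) :* (y :* y′)) refl

  module Conjugation (α α⁻¹ : ℕ → Carrier) (αα⁻¹≈1 : ∀ n → α n * α⁻¹ n ≈ 1#) where
    α⁻¹α≈1 : ∀ n → α⁻¹ n * α n ≈ 1#
    α⁻¹α≈1 n = trans (*-comm _ _) (αα⁻¹≈1 n)

    conjugate : Matrix → Matrix
    conjugate T n k = (α n * T n k) * α⁻¹ k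

    deconjugate : Matrix → Matrix
    deconjugate M n k = (α⁻¹ n * M n k) * α k

    conjugate-deconjugate : ∀ M → conjugate (deconjugate M) ≋ M
    conjugate-deconjugate M n k = cancel-sandwich (αα⁻¹≈1 n) (αα⁻¹≈1 k) (M n k)

    deconjugate-conjugate : ∀ T → deconjugate (conjugate T) ≋ T
    deconjugate-conjugate T n k = cancel-sandwich (α⁻¹α≈1 n) (α⁻¹α≈1 k) (T n k)

    deconjugate-cong : ∀ {M M′} → M ≋ M′ → deconjugate M ≋ deconjugate M′
    deconjugate-cong M≋M′ n k = *-congʳ (*-congˡ (M≋M′ n k))

    conjugate-I : conjugate I ≋ I
    conjugate-I = I-diagonal α α⁻¹ αα⁻¹≈1

    deconjugate-I : deconjugate I ≋ I
    deconjugate-I = I-diagonal α⁻¹ α α⁻¹α≈1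

    conjugate-· : ∀ S T → conjugate (S · T) ≋ (conjugate S · conjugate T)
    conjugate-· S T n k = sym (trans
      (sumTo-cong n (λ i _ → entry (α n) (S n i) (α⁻¹ i) (α i) (T i k) (α⁻¹ k) (α⁻¹α≈1 i)))
      (sumTo-factor n (α n) (α⁻¹ k) (λ i → S n i * T i k)))
      where
      entry : ∀ x s u v t y → u * v ≈ 1# → ((x * s) * u) * ((v * t) * y) ≈ (x * (s * t)) * y
      entry x s u v t y uv≈1 = trans (regroup x s u v t y) (trans (*-congˡ uv≈1) (*-identityʳ _))
        where
        regroup : ∀ x s u v t y → ((x * s) * u) * ((v * t) * y) ≈ ((x * (s * t)) * y) * (u * v)
        regroup = solve 6 (λ x s u v t y →
          ((x :* s) :* u) :* ((v :* t) :* y) := ((x :* (s :* t)) :* y) :* (u :* v)) refl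

    conjugate-^ : ∀ T j → conjugate (T ^ j) ≋ (conjugate T ^ j)
    conjugate-^ T zero    = conjugate-I
    conjugate-^ T (suc j) = ≋.trans (conjugate-· T (T ^ j)) (·-cong ≋.refl (conjugate-^ T j))

    antidiagonal-conjugate : ∀ T n k r →
      antidiagonal (conjugate T) n k r ≈ (segment α n r * antidiagonal T n k r) * segment α⁻¹ k r
    antidiagonal-conjugate T n k r = begin
      antidiagonal (conjugate T) n k r
        ≈⟨ prodTo-* r _ _ ⟩
      prodTo r (λ i → α (n +ℕ i) * T (n +ℕ i) (k +ℕ (r ∸ℕ i))) * prodTo r (λ i → α⁻¹ (k +ℕ (r ∸ℕ i)))
        ≈⟨ *-cong (prodTo-* r _ _) (prodTo-reverse r (λ i → α⁻¹ (k +ℕ i))) ⟩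
      (segment α n r * antidiagonal T n k r) * segment α⁻¹ k r ∎
      where open ≈-Reasoning

    -- Only the total length 1 + r + q enters the outer factors, and the Toeplitz segments
    -- forget their starting point.
    conjugate-Toeplitz-block : ∀ {T} → Toeplitz T → ∀ n k r q →
      antidiagonal (conjugate T) n k r * antidiagonal (conjugate T) (suc r +ℕ n) (suc r +ℕ k) q
        ≈ (segment α n (suc (r +ℕ q)) * (antidiagonal T n k r * antidiagonal T n k q))
          * segment α⁻¹ k (suc (r +ℕ q))
    conjugate-Toeplitz-block {T} T-toe n k r q = begin
      antidiagonal (conjugate T) n k r * antidiagonal (conjugate T) (suc r +ℕ n) (suc r +ℕ k) q
        ≈⟨ *-cong (antidiagonal-conjugate T n k r) (antidiagonal-conjugate T _ _ q) ⟩
      ((segment α n r * antidiagonal T n k r) * segment α⁻¹ k r)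
        * ((segment α (suc r +ℕ n) q * antidiagonal T (suc r +ℕ n) (suc r +ℕ k) q)
           * segment α⁻¹ (suc r +ℕ k) q)
        ≈⟨ trans (interchange _ _ _ _) (*-congʳ (interchange _ _ _ _)) ⟩
      ((segment α n r * segment α (suc r +ℕ n) q)
        * (antidiagonal T n k r * antidiagonal T (suc r +ℕ n) (suc r +ℕ k) q))
        * (segment α⁻¹ k r * segment α⁻¹ (suc r +ℕ k) q)
        ≈⟨ *-cong (*-cong (segment-append α n r q) (*-congˡ (antidiagonal-Toeplitz T-toe (suc r) n k q)))
                  (segment-append α⁻¹ k r q) ⟩
      (segment α n (suc (r +ℕ q)) * (antidiagonal T n k r * antidiagonal T n k q))
        * segment α⁻¹ k (suc (r +ℕ q)) ∎
      where open ≈-Reasoning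

    conjugate-Toeplitz-exchange : ∀ {T} → Toeplitz T → AntidiagonalExchange (conjugate T)
    conjugate-Toeplitz-exchange {T} T-toe n k r q = begin
      antidiagonal (conjugate T) n k r * antidiagonal (conjugate T) (suc r +ℕ n) (suc r +ℕ k) q
        ≈⟨ conjugate-Toeplitz-block T-toe n k r q ⟩
      (segment α n (suc (r +ℕ q)) * (antidiagonal T n k r * antidiagonal T n k q))
        * segment α⁻¹ k (suc (r +ℕ q))
        ≈⟨ reflexive (≡.cong (λ p → (segment α n (suc p) * (antidiagonal T n k r * antidiagonal T n k q)) * segment α⁻¹ k (suc p))
                       (ℕₚ.+-comm r q)) ⟩
      (segment α n (suc (q +ℕ r)) * (antidiagonal T n k r * antidiagonal T n k q))
        * segment α⁻¹ k (suc (q +ℕ r))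
        ≈⟨ *-congʳ (*-congˡ (*-comm _ _)) ⟩
      (segment α n (suc (q +ℕ r)) * (antidiagonal T n k q * antidiagonal T n k r))
        * segment α⁻¹ k (suc (q +ℕ r))
        ≈⟨ conjugate-Toeplitz-block T-toe n k q r ⟨
      antidiagonal (conjugate T) n k q * antidiagonal (conjugate T) (suc q +ℕ n) (suc q +ℕ k) r
        ≈⟨ *-comm _ _ ⟩
      antidiagonal (conjugate T) (suc q +ℕ n) (suc q +ℕ k) r * antidiagonal (conjugate T) n k q ∎
      where open ≈-Reasoning

    IsConjugateToeplitz : Matrix → Set (c ⊔ ℓ)
    IsConjugateToeplitz M = Σ[ T ∈ Matrix ] Toeplitz T × LowerTriangular T × M ≋ conjugate T

    ^-isConjugateToeplitz : ∀ {M} → IsConjugateToeplitz M → ∀ j → IsConjugateToeplitz (M ^ j)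
    ^-isConjugateToeplitz (T , T-toe , T-low , M≋T′) j =
      T ^ j , ^-Toeplitz T-toe T-low j , ^-lowerTriangular T-low j ,
      ≋.trans (^-cong M≋T′ j) (≋.sym (conjugate-^ T j))

    isConjugateToeplitz⇒SDR∞ : ∀ {M} → IsConjugateToeplitz M → SDR∞ M
    isConjugateToeplitz⇒SDR∞ {M} (T , T-toe , _ , M≋T′) = antidiagonalExchange⇒SDR∞ {M}
      (AntidiagonalExchange-resp {conjugate T} (≋.sym M≋T′) (conjugate-Toeplitz-exchange T-toe))

  module GenMatrix (a b : ℕ → Carrier) (b₀ : b 0 ≈ 1#) (ha : ∀ n → ¬ (a n ≈ 0#))
                   (Ainv : Matrix) (isInverse : IsInverse (genMatrix a b ha) Ainv) where
    a⁻¹ : ℕ → Carrier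
    a⁻¹ n = inv (a n) (ha n)

    open Conjugation a a⁻¹ (λ n → inverseʳ (a n) (ha n)) public

    A : Matrix
    A = genMatrix a b ha

    T : Matrix
    T = lowerToeplitz b

    A≋conjugate : A ≋ conjugate T
    A≋conjugate n k with k ≤? n
    ... | yes _ = refl
    ... | no  _ = sym (trans (*-congʳ (zeroʳ (a n))) (zeroˡ _))

    A-isConjugateToeplitz : IsConjugateToeplitz A
    A-isConjugateToeplitz = T , lowerToeplitz-Toeplitz b , lowerToeplitz-lowerTriangular b , A≋conjugate

    S : Matrix
    S = deconjugate Ainv

    S-lowerTriangular : LowerTriangular S
    S-lowerTriangular n k n<k =
      trans (*-congʳ (trans (*-congˡ (proj₁ isInverse n k n<k)) (zeroʳ _))) (zeroˡ _)

    T·S≋I : (T · S) ≋ I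
    T·S≋I = begin
      T · S                              ≈⟨ deconjugate-conjugate (T · S) ⟨
      deconjugate (conjugate (T · S))    ≈⟨ deconjugate-cong (conjugate-· T S) ⟩
      deconjugate (conjugate T · conjugate S)
        ≈⟨ deconjugate-cong (·-cong (≋.sym A≋conjugate) (conjugate-deconjugate Ainv)) ⟩
      deconjugate (A · Ainv)             ≈⟨ deconjugate-cong (proj₁ (proj₂ isInverse)) ⟩
      deconjugate I                      ≈⟨ deconjugate-I ⟩
      I                                  ∎
      where open ≋-Reasoning

    -- T · shift S and T · S agree because shifting T · S gives back the identity; cancelling
    -- the unitriangular T shows that S is Toeplitz.
    S-Toeplitz : Toeplitz S
    S-Toeplitz = ·-cancelˡ T-unit (λ n k → begin
      (T · shift S) n k        ≈⟨ ·-shift (lowerToeplitz-Toeplitz b) S-lowerTriangular n k ⟨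
      (T · S) (suc n) (suc k)  ≈⟨ T·S≋I (suc n) (suc k) ⟩
      I (suc n) (suc k)        ≈⟨ I-Toeplitz n k ⟩
      I n k                    ≈⟨ T·S≋I n k ⟨
      (T · S) n k              ∎)
      where
      open ≈-Reasoning
      T-unit : ∀ n → T n n ≈ 1#
      T-unit n = trans (lowerToeplitz-diagonal b n) b₀

    Ainv-isConjugateToeplitz : IsConjugateToeplitz Ainv
    Ainv-isConjugateToeplitz = S , S-Toeplitz , S-lowerTriangular , ≋.sym (conjugate-deconjugate Ainv)

    zpow-isConjugateToeplitz : ∀ j → IsConjugateToeplitz (zpow A Ainv j)
    zpow-isConjugateToeplitz (+ j)    = ^-isConjugateToeplitz A-isConjugateToeplitz j
    zpow-isConjugateToeplitz -[1+ j ] = ^-isConjugateToeplitz Ainv-isConjugateToeplitz (suc j)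

theorem2p2 : {c ℓ : Level} (F : Field c ℓ) →
    let open Field F in let open MatrixDefs F in
    (a b : ℕ → Carrier) (b₀ : b 0 ≈ 1#) (ha : ∀ n → ¬ (a n ≈ 0#)) →
    (Ainv : Matrix) → IsInverse (genMatrix a b ha) Ainv →
    (j : ℤ) → SDR∞ (zpow (genMatrix a b ha) Ainv j)
theorem2p2 F a b b₀ ha Ainv isInverse j = isConjugateToeplitz⇒SDR∞ (zpow-isConjugateToeplitz j)
  where open Matrices.GenMatrix F a b b₀ ha Ainv isInverse
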